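{- Let $\alpha\in\mathbb Z\setminus\{0,1\}$, put $\gamma=\alpha^2-\alpha+1$, and let $(h_n)$ be the sequence with $h_0=0$, $h_1=1$, $h_2=-\alpha^2(\alpha-1)\gamma$, $h_3=-\alpha^6(\alpha-1)^3\gamma^3$, $h_4=\alpha^{12}(\alpha-1)^6\gamma^5$, and for $m\ge2$: $h_{2m+1}=h_{m+2}h_m^3-h_{m-1}h_{m+1}^3$, for $m\ge 3$: $h_{2m}=h_m\big(h_{m+2}h_{m-1}^2-h_{m-2}h_{m+1}^2\big)/h_2$. (i) If $n\equiv 1,17\pmod{18}$, then $h_n$ is a square. (ii) If $n\equiv 5,13\pmod{18}$, then $h_n$ is a square if and only if $\alpha$ is a square.
   Context: The sequence defined is the elliptic divisibility sequence attached to the point $(0,0)$ of order $9$ on the Tate normal form curve with $c=\alpha^2(\alpha-1)$, $b=c(\alpha(\alpha-1)+1)$; its ninth term is zero. Convention: an integer $m$ is called a square if $m=\pm\beta^2$ for some nonzero integer $\beta$. -}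

module Defs where

open import Data.Nat as ℕ using (ℕ; zero; suc; _∸_)
open import Data.Integer.Base as ℤ using (ℤ; +_; -[1+_]; +[1+_]; _+_; _-_; _*_; -_; _^_; _/_)
open import Data.Product using (Σ; ∃; _×_; _,_)
open import Data.Sum using (_⊎_)
open import Relation.Nullary using (¬_)
open import Relation.Binary.PropositionalEquality using (_≡_)

-- Integer division, total: dividing by 0 gives 0 (never used for α ∉ {0,1},
-- since then h₂ ≠ 0).  For nonzero divisors this is stdlib's ℤ division.
divℤ : ℤ → ℤ → ℤ
divℤ a (+ zero) = + 0
divℤ a b@(+[1+ _ ]) = a / b
divℤ a b@(-[1+ _ ]) = a / b

γ : ℤ → ℤ
γ α = α * α - α + + 1

h₂ h₃ h₄ : ℤ → ℤ
h₂ α = - (α ^ 2 * (α - + 1) * γ α)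
h₃ α = - (α ^ 6 * (α - + 1) ^ 3 * γ α ^ 3)
h₄ α = α ^ 12 * (α - + 1) ^ 6 * γ α ^ 5

-- Fuel-indexed evaluation of the recursion; every recursive call is at a
-- strictly smaller index, so fuel (suc n) suffices to compute h n.
hF : ℤ → ℕ → ℕ → ℤ
hF α zero _ = + 0
hF α (suc f) 0 = + 0
hF α (suc f) 1 = + 1
hF α (suc f) 2 = h₂ α
hF α (suc f) 3 = h₃ α
hF α (suc f) 4 = h₄ α
hF α (suc f) n@(suc (suc (suc (suc (suc _))))) with n ℕ.% 2
... | 1 = let m = n ℕ./ 2 ; h = hF α f in
          h (m ℕ.+ 2) * h m ^ 3 - h (m ∸ 1) * h (m ℕ.+ 1) ^ 3
... | _ = let m = n ℕ./ 2 ; h = hF α f in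
          divℤ (h m * (h (m ℕ.+ 2) * h (m ∸ 1) ^ 2 - h (m ∸ 2) * h (m ℕ.+ 1) ^ 2)) (h₂ α)

h : ℤ → ℕ → ℤ
h α n = hF α (suc n) n

-- Paper's convention: m is a square if m = ±β² for some nonzero integer β.
IsSquare : ℤ → Set
IsSquare m = Σ ℤ λ β → ¬ (β ≡ + 0) × (m ≡ β * β ⊎ m ≡ - (β * β))

module Submission where

open import Defs
open import Data.Nat using (ℕ; _%_)
open import Data.Integer using (ℤ; +_)
open import Data.Product using (_×_)
open import Data.Sum using (_⊎_)
open import Function.Bundles using (_⇔_)
open import Relation.Nullary using (¬_)
open import Relation.Binary.PropositionalEquality using (_≡_)

open import Data.Empty using (⊥-elim)
open import Data.Fin as Fin using (Fin; toℕ)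
import Data.Fin.Properties as Finₚ
open import Data.Integer as ℤ using (∣_∣; -1ℤ; -[1+_]; +[1+_]; _+_; _-_; _*_; -_; _^_)
import Data.Integer.DivMod as ℤᵈ
import Data.Integer.Properties as ℤₚ
open import Data.Integer.Tactic.RingSolver using (solve-∀)
open import Data.List using (List; []; _∷_)
open import Data.List.Relation.Unary.All using (All; []; _∷_; all?)
open import Data.Nat as ℕ using (zero; suc; _≤_; _<_; z≤n; s≤s; _⊓_; _∸_)
open import Data.Nat.Coprimality using (Coprime; coprime-/gcd; coprime-divisor)
import Data.Nat.DivMod as ℕᵈ
open import Data.Nat.Divisibility using (divides; ∣-refl)
open import Data.Nat.GCD using (gcd; gcd[m,n]∣m; gcd[m,n]∣n; gcd[m,n]≢0)
import Data.Nat.Properties as ℕₚ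
open import Data.Nat.Tactic.RingSolver using () renaming (solve-∀ to ℕ-solve-∀)
open import Data.Product using (Σ; _,_; proj₁; proj₂)
open import Data.Sum using (inj₁; inj₂; [_,_]′)
open import Function.Bundles using (mk⇔; Equivalence)
open import Function.Properties.Equivalence using () renaming (trans to ⇔-trans; sym to ⇔-sym)
open import Relation.Nullary using (Dec)
open import Relation.Nullary.Decidable using (toWitness)
open import Relation.Binary.PropositionalEquality
  using (refl; sym; trans; cong; cong₂; subst; module ≡-Reasoning)

-- Theorem 5.15.  Write u = α, v = α − 1, w = γ = α² − α + 1.  Every term of h
-- is a signed monomial in u, v, w, and the proof makes this explicit:
--   * T n is a closed form, given by a table for n < 9 and Ward's
--     periodicity T (n + 9) = − T n · c₉^(9 + 2n) with c₉ = u⁷ v⁴ w³;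
--   * T satisfies the two duplication formulas defining h.  For the first
--     period (2 ≤ m ≤ 10, resp. 3 ≤ m ≤ 11) this is a finite check: after
--     cancelling the common monomial factor, each formula becomes a small
--     polynomial identity in α, decided by computation.  Periodicity rescales
--     all terms of a formula by the same factor, so the formulas hold for all m;
--   * h is the unique sequence with its initial values and duplication
--     formulas (h₂ ≠ 0 for α ∉ {0, 1}), hence h n = T n;
--   * over 18 = 2 · 9 steps the rescaling factor is a square, so for n ≡ o
--     (mod 18) h n = T o · Y² with Y ≠ 0, while T 1 = 1, T 17 = − z², T 5 = α z²
--     and T 13 = − α z².  Being a square is invariant under multiplication by
--     nonzero squares, so h n is a square iff 1, −1, α, −α respectively is.

-- Monomials c · u^a · v^b · w^d

data Mono : Set where
  mono : (coeff : ℤ) (expU expV expW : ℕ) → Mono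

infixl 7 _⊗_
infixr 8 _⊗^_

_⊗_ : Mono → Mono → Mono
mono c a b d ⊗ mono c′ a′ b′ d′ = mono (c * c′) (a ℕ.+ a′) (b ℕ.+ b′) (d ℕ.+ d′)

oneM : Mono
oneM = mono (+ 1) 0 0 0

negM : Mono → Mono
negM (mono c a b d) = mono (- c) a b d

_⊗^_ : Mono → ℕ → Mono
x ⊗^ zero  = oneM
x ⊗^ suc e = x ⊗ x ⊗^ e

gcdM : Mono → Mono → Mono → Mono
gcdM (mono _ a b d) (mono _ a′ b′ d′) (mono _ a″ b″ d″) =
  mono (+ 1) (a ⊓ a′ ⊓ a″) (b ⊓ b′ ⊓ b″) (d ⊓ d′ ⊓ d″)

_÷_ : Mono → Mono → Mono
mono c a b d ÷ mono _ a′ b′ d′ = mono c (a ∸ a′) (b ∸ b′) (d ∸ d′)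

module Evaluation (u v w : ℤ) where
  open ≡-Reasoning

  ⟦_⟧ : Mono → ℤ
  ⟦ mono c a b d ⟧ = c * (u ^ a * v ^ b * w ^ d)

  ⟦⊗⟧ : ∀ x y → ⟦ x ⊗ y ⟧ ≡ ⟦ x ⟧ * ⟦ y ⟧
  ⟦⊗⟧ (mono c a b d) (mono c′ a′ b′ d′) = begin
    c * c′ * (u ^ (a ℕ.+ a′) * v ^ (b ℕ.+ b′) * w ^ (d ℕ.+ d′))
      ≡⟨ cong₂ (λ p q → c * c′ * (p * q * w ^ (d ℕ.+ d′)))
               (ℤₚ.^-distribˡ-+-* u a a′) (ℤₚ.^-distribˡ-+-* v b b′) ⟩
    c * c′ * (u ^ a * u ^ a′ * (v ^ b * v ^ b′) * w ^ (d ℕ.+ d′))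
      ≡⟨ cong (λ r → c * c′ * (u ^ a * u ^ a′ * (v ^ b * v ^ b′) * r)) (ℤₚ.^-distribˡ-+-* w d d′) ⟩
    c * c′ * (u ^ a * u ^ a′ * (v ^ b * v ^ b′) * (w ^ d * w ^ d′))
      ≡⟨ shuffle c c′ (u ^ a) (u ^ a′) (v ^ b) (v ^ b′) (w ^ d) (w ^ d′) ⟩
    c * (u ^ a * v ^ b * w ^ d) * (c′ * (u ^ a′ * v ^ b′ * w ^ d′)) ∎
    where
    shuffle : ∀ c c′ x x′ y y′ z z′ →
      c * c′ * (x * x′ * (y * y′) * (z * z′)) ≡ c * (x * y * z) * (c′ * (x′ * y′ * z′))
    shuffle = solve-∀

  ⟦negM⟧ : ∀ x → ⟦ negM x ⟧ ≡ - ⟦ x ⟧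
  ⟦negM⟧ (mono c a b d) = sym (ℤₚ.neg-distribˡ-* c _)

  ⟦⊗^⟧ : ∀ x e → ⟦ x ⊗^ e ⟧ ≡ ⟦ x ⟧ ^ e
  ⟦⊗^⟧ x zero    = refl
  ⟦⊗^⟧ x (suc e) = trans (⟦⊗⟧ x (x ⊗^ e)) (cong (⟦ x ⟧ *_) (⟦⊗^⟧ x e))

  ⟦⊗⊗^⟧ : ∀ x y e → ⟦ x ⊗ y ⊗^ e ⟧ ≡ ⟦ x ⟧ * ⟦ y ⟧ ^ e
  ⟦⊗⊗^⟧ x y e = trans (⟦⊗⟧ x (y ⊗^ e)) (cong (⟦ x ⟧ *_) (⟦⊗^⟧ y e))

  factor : ∀ c {a b d a′ b′ d′} → a′ ≤ a → b′ ≤ b → d′ ≤ d →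
    ⟦ mono c a b d ⟧ ≡ ⟦ mono (+ 1) a′ b′ d′ ⟧ * ⟦ mono c (a ∸ a′) (b ∸ b′) (d ∸ d′) ⟧
  factor c {a} {b} {d} {a′} {b′} {d′} a′≤a b′≤b d′≤d = begin
    c * (u ^ a * v ^ b * w ^ d)
      ≡⟨ cong₂ (λ p q → c * (p * q * w ^ d)) (split u a′≤a) (split v b′≤b) ⟩
    c * (u ^ a′ * u ^ (a ∸ a′) * (v ^ b′ * v ^ (b ∸ b′)) * w ^ d)
      ≡⟨ cong (λ r → c * (u ^ a′ * u ^ (a ∸ a′) * (v ^ b′ * v ^ (b ∸ b′)) * r)) (split w d′≤d) ⟩
    c * (u ^ a′ * u ^ (a ∸ a′) * (v ^ b′ * v ^ (b ∸ b′)) * (w ^ d′ * w ^ (d ∸ d′)))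
      ≡⟨ shuffle c (u ^ a′) (u ^ (a ∸ a′)) (v ^ b′) (v ^ (b ∸ b′)) (w ^ d′) (w ^ (d ∸ d′)) ⟩
    + 1 * (u ^ a′ * v ^ b′ * w ^ d′) * (c * (u ^ (a ∸ a′) * v ^ (b ∸ b′) * w ^ (d ∸ d′))) ∎
    where
    split : ∀ x {m n} → m ≤ n → x ^ n ≡ x ^ m * x ^ (n ∸ m)
    split x {m} {n} m≤n = trans (cong (x ^_) (sym (ℕₚ.m+[n∸m]≡n m≤n))) (ℤₚ.^-distribˡ-+-* x m (n ∸ m))
    shuffle : ∀ c x x′ y y′ z z′ →
      c * (x * x′ * (y * y′) * (z * z′)) ≡ + 1 * (x * y * z) * (c * (x′ * y′ * z′))
    shuffle = solve-∀

  cancel : ∀ x y z → let g = gcdM x y z in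
    ⟦ x ÷ g ⟧ - ⟦ y ÷ g ⟧ ≡ ⟦ z ÷ g ⟧ → ⟦ x ⟧ - ⟦ y ⟧ ≡ ⟦ z ⟧
  cancel x@(mono c a b d) y@(mono c′ a′ b′ d′) z@(mono c″ a″ b″ d″) reduced = begin
    ⟦ x ⟧ - ⟦ y ⟧
      ≡⟨ cong₂ _-_ (factor c (first a a′ a″) (first b b′ b″) (first d d′ d″))
                   (factor c′ (second a a′ a″) (second b b′ b″) (second d d′ d″)) ⟩
    ⟦ g ⟧ * ⟦ x ÷ g ⟧ - ⟦ g ⟧ * ⟦ y ÷ g ⟧  ≡⟨ pull ⟦ g ⟧ ⟦ x ÷ g ⟧ ⟦ y ÷ g ⟧ ⟩
    ⟦ g ⟧ * (⟦ x ÷ g ⟧ - ⟦ y ÷ g ⟧)        ≡⟨ cong (⟦ g ⟧ *_) reduced ⟩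
    ⟦ g ⟧ * ⟦ z ÷ g ⟧                      ≡⟨ sym (factor c″ (third a a′ a″) (third b b′ b″) (third d d′ d″)) ⟩
    ⟦ z ⟧ ∎
    where
    g : Mono
    g = gcdM x y z
    pull : ∀ g p q → g * p - g * q ≡ g * (p - q)
    pull = solve-∀
    first : ∀ m n o → m ⊓ n ⊓ o ≤ m
    first m n o = ℕₚ.≤-trans (ℕₚ.m⊓n≤m (m ⊓ n) o) (ℕₚ.m⊓n≤m m n)
    second : ∀ m n o → m ⊓ n ⊓ o ≤ n
    second m n o = ℕₚ.≤-trans (ℕₚ.m⊓n≤m (m ⊓ n) o) (ℕₚ.m⊓n≤n m n)
    third : ∀ m n o → m ⊓ n ⊓ o ≤ o
    third m n o = ℕₚ.m⊓n≤n (m ⊓ n) o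

-- Polynomials in one variable, as coefficient lists (lowest degree first)

Poly : Set
Poly = List ℤ

infixl 6 _+ₚ_ _-ₚ_
infixl 7 _*ₚ_

evalP : Poly → ℤ → ℤ
evalP []       x = + 0
evalP (c ∷ p)  x = c + x * evalP p x

_+ₚ_ : Poly → Poly → Poly
[]      +ₚ q       = q
(c ∷ p) +ₚ []      = c ∷ p
(c ∷ p) +ₚ (d ∷ q) = c + d ∷ p +ₚ q

scaleₚ : ℤ → Poly → Poly
scaleₚ k []      = []
scaleₚ k (c ∷ p) = k * c ∷ scaleₚ k p

_-ₚ_ : Poly → Poly → Poly
p -ₚ q = p +ₚ scaleₚ (- + 1) q

_*ₚ_ : Poly → Poly → Poly
[]      *ₚ q = []
(c ∷ p) *ₚ q = scaleₚ c q +ₚ (+ 0 ∷ p *ₚ q)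

_^ₚ_ : Poly → ℕ → Poly
p ^ₚ zero  = + 1 ∷ []
p ^ₚ suc e = p *ₚ p ^ₚ e

module _ (x : ℤ) where
  evalP-+ₚ : ∀ p q → evalP (p +ₚ q) x ≡ evalP p x + evalP q x
  evalP-+ₚ []      q       = sym (ℤₚ.+-identityˡ _)
  evalP-+ₚ (c ∷ p) []      = sym (ℤₚ.+-identityʳ _)
  evalP-+ₚ (c ∷ p) (d ∷ q) = trans (cong (λ r → c + d + x * r) (evalP-+ₚ p q)) (rearrange c d x _ _)
    where
    rearrange : ∀ c d x p q → c + d + x * (p + q) ≡ c + x * p + (d + x * q)
    rearrange = solve-∀

  evalP-scaleₚ : ∀ k p → evalP (scaleₚ k p) x ≡ k * evalP p x
  evalP-scaleₚ k []      = sym (ℤₚ.*-zeroʳ k)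
  evalP-scaleₚ k (c ∷ p) = trans (cong (λ r → k * c + x * r) (evalP-scaleₚ k p)) (rearrange k c x _)
    where
    rearrange : ∀ k c x p → k * c + x * (k * p) ≡ k * (c + x * p)
    rearrange = solve-∀

  evalP--ₚ : ∀ p q → evalP (p -ₚ q) x ≡ evalP p x - evalP q x
  evalP--ₚ p q = trans (evalP-+ₚ p (scaleₚ (- + 1) q))
                       (cong (λ r → evalP p x + r) (trans (evalP-scaleₚ (- + 1) q) (ℤₚ.-1*i≡-i _)))

  evalP-*ₚ : ∀ p q → evalP (p *ₚ q) x ≡ evalP p x * evalP q x
  evalP-*ₚ []      q = sym (ℤₚ.*-zeroˡ (evalP q x))
  evalP-*ₚ (c ∷ p) q = begin
    evalP (scaleₚ c q +ₚ (+ 0 ∷ p *ₚ q)) x        ≡⟨ evalP-+ₚ (scaleₚ c q) (+ 0 ∷ p *ₚ q) ⟩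
    evalP (scaleₚ c q) x + (+ 0 + x * evalP (p *ₚ q) x)
      ≡⟨ cong₂ (λ r s → r + (+ 0 + x * s)) (evalP-scaleₚ c q) (evalP-*ₚ p q) ⟩
    c * evalP q x + (+ 0 + x * (evalP p x * evalP q x)) ≡⟨ rearrange c x (evalP p x) (evalP q x) ⟩
    (c + x * evalP p x) * evalP q x ∎
    where
    open ≡-Reasoning
    rearrange : ∀ c x p q → c * q + (+ 0 + x * (p * q)) ≡ (c + x * p) * q
    rearrange = solve-∀

  evalP-^ₚ : ∀ p e → evalP (p ^ₚ e) x ≡ evalP p x ^ e
  evalP-^ₚ p zero    = trans (cong (λ r → + 1 + r) (ℤₚ.*-zeroʳ x)) (ℤₚ.+-identityʳ (+ 1))
  evalP-^ₚ p (suc e) = trans (evalP-*ₚ p (p ^ₚ e)) (cong (evalP p x *_) (evalP-^ₚ p e))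

  evalP-null : ∀ {p} → All (_≡ + 0) p → evalP p x ≡ + 0
  evalP-null []                = refl
  evalP-null (refl ∷ c≡0s) = trans (ℤₚ.+-identityˡ _) (trans (cong (x *_) (evalP-null c≡0s)) (ℤₚ.*-zeroʳ x))

-- Monomial identities in the Tate parameters u = α, v = α − 1,
-- w = γ = α² − α + 1, decided by computing with polynomials in α

Uₚ Vₚ Wₚ : Poly
Uₚ = + 0 ∷ + 1 ∷ []
Vₚ = -[1+ 0 ] ∷ + 1 ∷ []
Wₚ = + 1 ∷ -[1+ 0 ] ∷ + 1 ∷ []

monoPoly : Mono → Poly
monoPoly (mono c a b d) = (c ∷ []) *ₚ (Uₚ ^ₚ a *ₚ Vₚ ^ₚ b *ₚ Wₚ ^ₚ d)

residual : Mono → Mono → Mono → Poly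
residual x y z = monoPoly x -ₚ monoPoly y -ₚ monoPoly z

Identity : Mono → Mono → Mono → Set
Identity x y z = All (_≡ + 0) (residual (x ÷ g) (y ÷ g) (z ÷ g))
  where
  g : Mono
  g = gcdM x y z

identity? : ∀ x y z → Dec (Identity x y z)
identity? x y z = all? (ℤ._≟ + 0) (residual (x ÷ g) (y ÷ g) (z ÷ g))
  where
  g : Mono
  g = gcdM x y z

module Tate (α : ℤ) where
  open Evaluation α (α - + 1) (γ α) public
  open ≡-Reasoning

  evalP-monoPoly : ∀ x → evalP (monoPoly x) α ≡ ⟦ x ⟧
  evalP-monoPoly (mono c a b d) = begin
    evalP ((c ∷ []) *ₚ (Uₚ ^ₚ a *ₚ Vₚ ^ₚ b *ₚ Wₚ ^ₚ d)) α
      ≡⟨ evalP-*ₚ α (c ∷ []) (Uₚ ^ₚ a *ₚ Vₚ ^ₚ b *ₚ Wₚ ^ₚ d) ⟩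
    evalP (c ∷ []) α * evalP (Uₚ ^ₚ a *ₚ Vₚ ^ₚ b *ₚ Wₚ ^ₚ d) α
      ≡⟨ cong₂ _*_ (constant c) (trans (evalP-*ₚ α (Uₚ ^ₚ a *ₚ Vₚ ^ₚ b) (Wₚ ^ₚ d))
                                       (cong₂ _*_ (evalP-*ₚ α (Uₚ ^ₚ a) (Vₚ ^ₚ b)) refl)) ⟩
    c * (evalP (Uₚ ^ₚ a) α * evalP (Vₚ ^ₚ b) α * evalP (Wₚ ^ₚ d) α)
      ≡⟨ cong (c *_) (cong₂ _*_ (cong₂ _*_ (power Uₚ a (atU α)) (power Vₚ b (atV α))) (power Wₚ d (atW α))) ⟩
    c * (α ^ a * (α - + 1) ^ b * γ α ^ d) ∎
    where
    constant : ∀ c → evalP (c ∷ []) α ≡ c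
    constant c = trans (cong (λ r → c + r) (ℤₚ.*-zeroʳ α)) (ℤₚ.+-identityʳ c)
    power : ∀ p e {r} → evalP p α ≡ r → evalP (p ^ₚ e) α ≡ r ^ e
    power p e refl = evalP-^ₚ α p e
    -- the left-hand sides are evalP Uₚ α, evalP Vₚ α, evalP Wₚ α, unfolded
    atU : ∀ α → + 0 + α * (+ 1 + α * + 0) ≡ α
    atU = solve-∀
    atV : ∀ α → -[1+ 0 ] + α * (+ 1 + α * + 0) ≡ α - + 1
    atV = solve-∀
    atW : ∀ α → + 1 + α * (-[1+ 0 ] + α * (+ 1 + α * + 0)) ≡ α * α - α + + 1
    atW = solve-∀

  residual-sound : ∀ x y z → All (_≡ + 0) (residual x y z) → ⟦ x ⟧ - ⟦ y ⟧ ≡ ⟦ z ⟧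
  residual-sound x y z null = begin
    ⟦ x ⟧ - ⟦ y ⟧                    ≡⟨ solve-for (⟦ x ⟧ - ⟦ y ⟧) ⟦ z ⟧ ⟩
    (⟦ x ⟧ - ⟦ y ⟧ - ⟦ z ⟧) + ⟦ z ⟧  ≡⟨ cong (_+ ⟦ z ⟧) (sym value) ⟩
    evalP (residual x y z) α + ⟦ z ⟧ ≡⟨ cong (_+ ⟦ z ⟧) (evalP-null α null) ⟩
    + 0 + ⟦ z ⟧                      ≡⟨ ℤₚ.+-identityˡ ⟦ z ⟧ ⟩
    ⟦ z ⟧ ∎
    where
    solve-for : ∀ p q → p ≡ (p - q) + q
    solve-for = solve-∀
    value : evalP (residual x y z) α ≡ ⟦ x ⟧ - ⟦ y ⟧ - ⟦ z ⟧
    value = trans (evalP--ₚ α (monoPoly x -ₚ monoPoly y) (monoPoly z))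
                  (cong₂ _-_ (trans (evalP--ₚ α (monoPoly x) (monoPoly y))
                                    (cong₂ _-_ (evalP-monoPoly x) (evalP-monoPoly y)))
                             (evalP-monoPoly z))

  identity-sound : ∀ x y z → Identity x y z → ⟦ x ⟧ - ⟦ y ⟧ ≡ ⟦ z ⟧
  identity-sound x y z id = cancel x y z (residual-sound (x ÷ g) (y ÷ g) (z ÷ g) id)
    where
    g : Mono
    g = gcdM x y z

-- The closed form of the sequence as monomials in u, v, w

-- c₉ = u⁷ v⁴ w³: shifting the index by 9 multiplies by −c₉^(9+2n).
c₉ : Mono
c₉ = mono (+ 1) 7 4 3

T : ℕ → Mono
T 0 = mono (+ 0) 0 0 0
T 1 = mono (+ 1) 0 0 0
T 2 = mono -1ℤ 2 1 1
T 3 = mono -1ℤ 6 3 3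
T 4 = mono (+ 1) 12 6 5
T 5 = mono (+ 1) 19 10 8
T 6 = mono -1ℤ 27 15 12
T 7 = mono -1ℤ 37 21 16
T 8 = mono (+ 1) 49 28 21
T (suc (suc (suc (suc (suc (suc (suc (suc (suc n))))))))) = negM (T n) ⊗ c₉ ⊗^ (9 ℕ.+ 2 ℕ.* n)

OddExpr EvenExpr : (ℕ → ℤ) → ℕ → ℤ
OddExpr  t m = t (m ℕ.+ 2) * t m ^ 3 - t (m ∸ 1) * t (m ℕ.+ 1) ^ 3
EvenExpr t m = t m * (t (m ℕ.+ 2) * t (m ∸ 1) ^ 2 - t (m ∸ 2) * t (m ℕ.+ 1) ^ 2)

OddRel EvenRel : (ℕ → ℤ) → ℕ → Set
OddRel  t m = OddExpr t m ≡ t (1 ℕ.+ m ℕ.* 2)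
EvenRel t m = EvenExpr t m ≡ t 2 * t (m ℕ.* 2)

OddIdentity EvenIdentity : ℕ → Set
OddIdentity m = Identity (T (m ℕ.+ 2) ⊗ T m ⊗^ 3) (T (m ∸ 1) ⊗ T (m ℕ.+ 1) ⊗^ 3) (T (1 ℕ.+ m ℕ.* 2))
EvenIdentity m = Identity (T m ⊗ (T (m ℕ.+ 2) ⊗ T (m ∸ 1) ⊗^ 2))
                          (T m ⊗ (T (m ∸ 2) ⊗ T (m ℕ.+ 1) ⊗^ 2))
                          (T 2 ⊗ T (m ℕ.* 2))

oddIdentity? : ∀ m → Dec (OddIdentity m)
oddIdentity? m = identity? (T (m ℕ.+ 2) ⊗ T m ⊗^ 3) (T (m ∸ 1) ⊗ T (m ℕ.+ 1) ⊗^ 3) (T (1 ℕ.+ m ℕ.* 2))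

evenIdentity? : ∀ m → Dec (EvenIdentity m)
evenIdentity? m = identity? (T m ⊗ (T (m ℕ.+ 2) ⊗ T (m ∸ 1) ⊗^ 2))
                            (T m ⊗ (T (m ∸ 2) ⊗ T (m ℕ.+ 1) ⊗^ 2))
                            (T 2 ⊗ T (m ℕ.* 2))

odd-identity-base : ∀ (i : Fin 9) → OddIdentity (2 ℕ.+ toℕ i)
odd-identity-base = toWitness {a? = Finₚ.all? (λ i → oddIdentity? (2 ℕ.+ toℕ i))} _

even-identity-base : ∀ (i : Fin 9) → EvenIdentity (3 ℕ.+ toℕ i)
even-identity-base = toWitness {a? = Finₚ.all? (λ i → evenIdentity? (3 ℕ.+ toℕ i))} _

odd-scaled : ∀ σa σb σc σd σ {a b c d e} →
  σa * σb * σb * σb ≡ σ → σc * σd * σd * σd ≡ σ → a * b ^ 3 - c * d ^ 3 ≡ e →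
  (σa * a) * (σb * b) ^ 3 - (σc * c) * (σd * d) ^ 3 ≡ σ * e
odd-scaled σa σb σc σd σ {a} {b} {c} {d} {e} first second formula = begin
  (σa * a) * (σb * b) ^ 3 - (σc * c) * (σd * d) ^ 3
    ≡⟨ rearrange σa σb σc σd a b c d ⟩
  (σa * σb * σb * σb) * (a * b ^ 3) - (σc * σd * σd * σd) * (c * d ^ 3)
    ≡⟨ cong₂ (λ p q → p * (a * b ^ 3) - q * (c * d ^ 3)) first second ⟩
  σ * (a * b ^ 3) - σ * (c * d ^ 3) ≡⟨ pull σ (a * b ^ 3) (c * d ^ 3) ⟩
  σ * (a * b ^ 3 - c * d ^ 3)       ≡⟨ cong (σ *_) formula ⟩
  σ * e ∎
  where
  open ≡-Reasoning
  -- (powers unfolded for the solver: x ^ 3 = x * (x * (x * 1)))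
  rearrange : ∀ σa σb σc σd a b c d →
    (σa * a) * ((σb * b) * ((σb * b) * ((σb * b) * + 1)))
      - (σc * c) * ((σd * d) * ((σd * d) * ((σd * d) * + 1)))
      ≡ (σa * σb * σb * σb) * (a * (b * (b * (b * + 1))))
        - (σc * σd * σd * σd) * (c * (d * (d * (d * + 1))))
  rearrange = solve-∀
  pull : ∀ g p q → g * p - g * q ≡ g * (p - q)
  pull = solve-∀

even-scaled : ∀ σa σb σc σd σe σ {a b c d e t f} →
  σa * σb * σc * σc ≡ σ → σa * σd * σe * σe ≡ σ → a * (b * c ^ 2 - d * e ^ 2) ≡ t * f →
  (σa * a) * ((σb * b) * (σc * c) ^ 2 - (σd * d) * (σe * e) ^ 2) ≡ t * (σ * f)
even-scaled σa σb σc σd σe σ {a} {b} {c} {d} {e} {t} {f} first second formula = begin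
  (σa * a) * ((σb * b) * (σc * c) ^ 2 - (σd * d) * (σe * e) ^ 2)
    ≡⟨ rearrange σa σb σc σd σe a b c d e ⟩
  (σa * σb * σc * σc) * (a * (b * c ^ 2)) - (σa * σd * σe * σe) * (a * (d * e ^ 2))
    ≡⟨ cong₂ (λ p q → p * (a * (b * c ^ 2)) - q * (a * (d * e ^ 2))) first second ⟩
  σ * (a * (b * c ^ 2)) - σ * (a * (d * e ^ 2)) ≡⟨ pull σ a (b * c ^ 2) (d * e ^ 2) ⟩
  σ * (a * (b * c ^ 2 - d * e ^ 2))           ≡⟨ cong (σ *_) formula ⟩
  σ * (t * f)                                 ≡⟨ swap σ t f ⟩
  t * (σ * f) ∎
  where
  open ≡-Reasoning
  -- (powers unfolded for the solver: x ^ 2 = x * (x * 1))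
  rearrange : ∀ σa σb σc σd σe a b c d e →
    (σa * a) * ((σb * b) * ((σc * c) * ((σc * c) * + 1)) - (σd * d) * ((σe * e) * ((σe * e) * + 1)))
      ≡ (σa * σb * σc * σc) * (a * (b * (c * (c * + 1))))
        - (σa * σd * σe * σe) * (a * (d * (e * (e * + 1))))
  rearrange = solve-∀
  pull : ∀ g a p q → g * (a * p) - g * (a * q) ≡ g * (a * (p - q))
  pull = solve-∀
  swap : ∀ σ t f → σ * (t * f) ≡ t * (σ * f)
  swap = solve-∀

period-decomposition : ∀ c m → c ≤ m → Σ ℕ λ k → Σ (Fin 9) λ i → m ≡ k ℕ.* 9 ℕ.+ (c ℕ.+ toℕ i)
period-decomposition c m c≤m = r ℕ./ 9 , Fin.fromℕ< (ℕᵈ.m%n<n r 9) , (begin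
  m                               ≡⟨ sym (ℕₚ.m+[n∸m]≡n c≤m) ⟩
  c ℕ.+ r                         ≡⟨ cong (c ℕ.+_) (ℕᵈ.m≡m%n+[m/n]*n r 9) ⟩
  c ℕ.+ (r ℕ.% 9 ℕ.+ r ℕ./ 9 ℕ.* 9) ≡⟨ rearrange c (r ℕ.% 9) (r ℕ./ 9) ⟩
  r ℕ./ 9 ℕ.* 9 ℕ.+ (c ℕ.+ r ℕ.% 9) ≡⟨ cong (λ j → r ℕ./ 9 ℕ.* 9 ℕ.+ (c ℕ.+ j)) (sym (Finₚ.toℕ-fromℕ< _)) ⟩
  r ℕ./ 9 ℕ.* 9 ℕ.+ (c ℕ.+ toℕ (Fin.fromℕ< (ℕᵈ.m%n<n r 9))) ∎)
  where
  open ≡-Reasoning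
  r : ℕ
  r = m ∸ c
  rearrange : ∀ c j q → c ℕ.+ (j ℕ.+ q ℕ.* 9) ≡ q ℕ.* 9 ℕ.+ (c ℕ.+ j)
  rearrange = ℕ-solve-∀

module ClosedForm (α : ℤ) where
  open Tate α
  open ≡-Reasoning

  T′ : ℕ → ℤ
  T′ n = ⟦ T n ⟧

  odd-from-identity : ∀ m → OddIdentity m → OddRel T′ m
  odd-from-identity m id = begin
    OddExpr T′ m
      ≡⟨ sym (cong₂ _-_ (⟦⊗⊗^⟧ (T (m ℕ.+ 2)) (T m) 3) (⟦⊗⊗^⟧ (T (m ∸ 1)) (T (m ℕ.+ 1)) 3)) ⟩
    ⟦ T (m ℕ.+ 2) ⊗ T m ⊗^ 3 ⟧ - ⟦ T (m ∸ 1) ⊗ T (m ℕ.+ 1) ⊗^ 3 ⟧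
      ≡⟨ identity-sound (T (m ℕ.+ 2) ⊗ T m ⊗^ 3) (T (m ∸ 1) ⊗ T (m ℕ.+ 1) ⊗^ 3) (T (1 ℕ.+ m ℕ.* 2)) id ⟩
    T′ (1 ℕ.+ m ℕ.* 2) ∎

  even-from-identity : ∀ m → EvenIdentity m → EvenRel T′ m
  even-from-identity m id = begin
    EvenExpr T′ m
      ≡⟨ distribute (T′ m) (T′ (m ℕ.+ 2) * T′ (m ∸ 1) ^ 2) (T′ (m ∸ 2) * T′ (m ℕ.+ 1) ^ 2) ⟩
    T′ m * (T′ (m ℕ.+ 2) * T′ (m ∸ 1) ^ 2) - T′ m * (T′ (m ∸ 2) * T′ (m ℕ.+ 1) ^ 2)
      ≡⟨ sym (cong₂ _-_ (product (T m) (T (m ℕ.+ 2)) (T (m ∸ 1))) (product (T m) (T (m ∸ 2)) (T (m ℕ.+ 1)))) ⟩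
    ⟦ T m ⊗ (T (m ℕ.+ 2) ⊗ T (m ∸ 1) ⊗^ 2) ⟧ - ⟦ T m ⊗ (T (m ∸ 2) ⊗ T (m ℕ.+ 1) ⊗^ 2) ⟧
      ≡⟨ identity-sound (T m ⊗ (T (m ℕ.+ 2) ⊗ T (m ∸ 1) ⊗^ 2)) (T m ⊗ (T (m ∸ 2) ⊗ T (m ℕ.+ 1) ⊗^ 2))
                        (T 2 ⊗ T (m ℕ.* 2)) id ⟩
    ⟦ T 2 ⊗ T (m ℕ.* 2) ⟧ ≡⟨ ⟦⊗⟧ (T 2) (T (m ℕ.* 2)) ⟩
    T′ 2 * T′ (m ℕ.* 2) ∎
    where
    distribute : ∀ a p q → a * (p - q) ≡ a * p - a * q
    distribute = solve-∀
    product : ∀ x y z → ⟦ x ⊗ (y ⊗ z ⊗^ 2) ⟧ ≡ ⟦ x ⟧ * (⟦ y ⟧ * ⟦ z ⟧ ^ 2)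
    product x y z = trans (⟦⊗⟧ x (y ⊗ z ⊗^ 2)) (cong (⟦ x ⟧ *_) (⟦⊗⊗^⟧ y z 2))

  odd-base : ∀ (i : Fin 9) → OddRel T′ (2 ℕ.+ toℕ i)
  odd-base i = odd-from-identity (2 ℕ.+ toℕ i) (odd-identity-base i)

  even-base : ∀ (i : Fin 9) → EvenRel T′ (3 ℕ.+ toℕ i)
  even-base i = even-from-identity (3 ℕ.+ toℕ i) (even-identity-base i)

  -- The value of c₉, kept opaque so that its large powers are never unfolded.
  opaque
    c : ℤ
    c = ⟦ c₉ ⟧

    c≡⟦c₉⟧ : c ≡ ⟦ c₉ ⟧
    c≡⟦c₉⟧ = refl

  E : ℕ → ℕ → ℕ
  E k o = k ℕ.* (k ℕ.* 9 ℕ.+ 2 ℕ.* o)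

  σ : ℕ → ℕ → ℤ
  σ k o = -1ℤ ^ k * c ^ E k o

  -- half of E (q + q) o
  F : ℕ → ℕ → ℕ
  F q o = q ℕ.* ((q ℕ.+ q) ℕ.* 9 ℕ.+ 2 ℕ.* o)

  ⟦⊗c₉^⟧ : ∀ x e → ⟦ x ⊗ c₉ ⊗^ e ⟧ ≡ ⟦ x ⟧ * c ^ e
  ⟦⊗c₉^⟧ x e = trans (⟦⊗⊗^⟧ x c₉ e) (cong (λ y → ⟦ x ⟧ * y ^ e) (sym c≡⟦c₉⟧))

  ward : ∀ k o → T′ (k ℕ.* 9 ℕ.+ o) ≡ σ k o * T′ o
  ward zero    o = sym (ℤₚ.*-identityˡ (T′ o))
  ward (suc k) o = begin
    ⟦ negM (T n) ⊗ c₉ ⊗^ (9 ℕ.+ 2 ℕ.* n) ⟧     ≡⟨ ⟦⊗c₉^⟧ (negM (T n)) (9 ℕ.+ 2 ℕ.* n) ⟩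
    ⟦ negM (T n) ⟧ * c ^ (9 ℕ.+ 2 ℕ.* n)       ≡⟨ cong (_* c ^ (9 ℕ.+ 2 ℕ.* n)) (⟦negM⟧ (T n)) ⟩
    - T′ n * c ^ (9 ℕ.+ 2 ℕ.* n)               ≡⟨ cong (λ r → - r * c ^ (9 ℕ.+ 2 ℕ.* n)) (ward k o) ⟩
    - (σ k o * T′ o) * c ^ (9 ℕ.+ 2 ℕ.* n)
      ≡⟨ rearrange (-1ℤ ^ k) (c ^ E k o) (T′ o) (c ^ (9 ℕ.+ 2 ℕ.* n)) ⟩
    -1ℤ ^ suc k * (c ^ E k o * c ^ (9 ℕ.+ 2 ℕ.* n)) * T′ o
      ≡⟨ cong (λ r → -1ℤ ^ suc k * r * T′ o) (sym (ℤₚ.^-distribˡ-+-* c (E k o) (9 ℕ.+ 2 ℕ.* n))) ⟩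
    -1ℤ ^ suc k * c ^ (E k o ℕ.+ (9 ℕ.+ 2 ℕ.* n)) * T′ o
      ≡⟨ cong (λ e → -1ℤ ^ suc k * c ^ e * T′ o) (exponent k o) ⟩
    σ (suc k) o * T′ o ∎
    where
    n : ℕ
    n = k ℕ.* 9 ℕ.+ o
    rearrange : ∀ s p t q → - (s * p * t) * q ≡ -1ℤ * s * (p * q) * t
    rearrange = solve-∀
    exponent : ∀ k o → E k o ℕ.+ (9 ℕ.+ 2 ℕ.* (k ℕ.* 9 ℕ.+ o)) ≡ E (suc k) o
    exponent = unfolded
      where
      unfolded : ∀ k o → k ℕ.* (k ℕ.* 9 ℕ.+ 2 ℕ.* o) ℕ.+ (9 ℕ.+ 2 ℕ.* (k ℕ.* 9 ℕ.+ o))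
                       ≡ (1 ℕ.+ k) ℕ.* ((1 ℕ.+ k) ℕ.* 9 ℕ.+ 2 ℕ.* o)
      unfolded = ℕ-solve-∀

  sign-square : ∀ k → -1ℤ ^ k * -1ℤ ^ k ≡ + 1
  sign-square zero    = refl
  sign-square (suc k) = trans (cancel-signs (-1ℤ ^ k)) (sign-square k)
    where
    cancel-signs : ∀ s → -1ℤ * s * (-1ℤ * s) ≡ s * s
    cancel-signs = solve-∀

  σ-four : ∀ k a b d e f → E k a ℕ.+ E k b ℕ.+ E k d ℕ.+ E k e ≡ E (k ℕ.+ k) f →
    σ k a * σ k b * σ k d * σ k e ≡ σ (k ℕ.+ k) f
  σ-four k a b d e f exponents = begin
    σ k a * σ k b * σ k d * σ k e
      ≡⟨ rearrange s (c ^ E k a) (c ^ E k b) (c ^ E k d) (c ^ E k e) ⟩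
    s * s * (s * s) * (c ^ E k a * c ^ E k b * c ^ E k d * c ^ E k e)
      ≡⟨ cong₂ (λ p q → p * p * q) (sign-square k) (merge (E k a) (E k b) (E k d) (E k e)) ⟩
    + 1 * + 1 * c ^ (E k a ℕ.+ E k b ℕ.+ E k d ℕ.+ E k e)
      ≡⟨ cong (λ r → + 1 * + 1 * c ^ r) exponents ⟩
    + 1 * + 1 * c ^ E (k ℕ.+ k) f
      ≡⟨ cong (λ p → p * c ^ E (k ℕ.+ k) f) (sym (trans (ℤₚ.^-distribˡ-+-* -1ℤ k k) (sign-square k))) ⟩
    σ (k ℕ.+ k) f ∎
    where
    s = -1ℤ ^ k
    rearrange : ∀ s p q r t → s * p * (s * q) * (s * r) * (s * t) ≡ s * s * (s * s) * (p * q * r * t)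
    rearrange = solve-∀
    merge : ∀ m n o p → c ^ m * c ^ n * c ^ o * c ^ p ≡ c ^ (m ℕ.+ n ℕ.+ o ℕ.+ p)
    merge m n o p = sym (trans (ℤₚ.^-distribˡ-+-* c (m ℕ.+ n ℕ.+ o) p)
                        (cong (_* c ^ p) (trans (ℤₚ.^-distribˡ-+-* c (m ℕ.+ n) o)
                                                (cong (_* c ^ o) (ℤₚ.^-distribˡ-+-* c m n)))))

  σ-double : ∀ q o → σ (q ℕ.+ q) o ≡ c ^ F q o * c ^ F q o
  σ-double q o = begin
    -1ℤ ^ (q ℕ.+ q) * c ^ E (q ℕ.+ q) o
      ≡⟨ cong₂ _*_ (trans (ℤₚ.^-distribˡ-+-* -1ℤ q q) (sign-square q)) (cong (c ^_) (halve q o)) ⟩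
    + 1 * c ^ (F q o ℕ.+ F q o)        ≡⟨ ℤₚ.*-identityˡ _ ⟩
    c ^ (F q o ℕ.+ F q o)              ≡⟨ ℤₚ.^-distribˡ-+-* c (F q o) (F q o) ⟩
    c ^ F q o * c ^ F q o ∎
    where
    halve : ∀ q o → (q ℕ.+ q) ℕ.* ((q ℕ.+ q) ℕ.* 9 ℕ.+ 2 ℕ.* o)
                  ≡ q ℕ.* ((q ℕ.+ q) ℕ.* 9 ℕ.+ 2 ℕ.* o) ℕ.+ q ℕ.* ((q ℕ.+ q) ℕ.* 9 ℕ.+ 2 ℕ.* o)
    halve = ℕ-solve-∀

  ward-at : ∀ k {n} o → n ≡ k ℕ.* 9 ℕ.+ o → T′ n ≡ σ k o * T′ o
  ward-at k o refl = ward k o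

  odd-lift : ∀ k m → OddRel T′ (suc m) → OddRel T′ (k ℕ.* 9 ℕ.+ suc m)
  odd-lift k m formula = begin
    OddExpr T′ M
      ≡⟨ cong₂ _-_ (cong₂ (λ p q → p * q ^ 3) (ward-at k (suc m ℕ.+ 2) (ℕₚ.+-assoc (k ℕ.* 9) (suc m) 2))
                                            (ward k (suc m)))
                   (cong₂ (λ p q → p * q ^ 3) (ward-at k m (cong (_∸ 1) (ℕₚ.+-suc (k ℕ.* 9) m)))
                                            (ward-at k (suc m ℕ.+ 1) (ℕₚ.+-assoc (k ℕ.* 9) (suc m) 1))) ⟩
    (σ k (suc m ℕ.+ 2) * T′ (suc m ℕ.+ 2)) * (σ k (suc m) * T′ (suc m)) ^ 3
      - (σ k m * T′ m) * (σ k (suc m ℕ.+ 1) * T′ (suc m ℕ.+ 1)) ^ 3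
      ≡⟨ odd-scaled (σ k (suc m ℕ.+ 2)) (σ k (suc m)) (σ k m) (σ k (suc m ℕ.+ 1)) (σ (k ℕ.+ k) f)
                    (σ-four k (suc m ℕ.+ 2) (suc m) (suc m) (suc m) f (first k m))
                    (σ-four k m (suc m ℕ.+ 1) (suc m ℕ.+ 1) (suc m ℕ.+ 1) f (second k m)) formula ⟩
    σ (k ℕ.+ k) (1 ℕ.+ suc m ℕ.* 2) * T′ (1 ℕ.+ suc m ℕ.* 2)
      ≡⟨ sym (ward-at (k ℕ.+ k) (1 ℕ.+ suc m ℕ.* 2) (index k m)) ⟩
    T′ (1 ℕ.+ M ℕ.* 2) ∎
    where
    M f : ℕ
    M = k ℕ.* 9 ℕ.+ suc m
    f = 1 ℕ.+ suc m ℕ.* 2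
    -- exponents of the two terms and the target, with E unfolded
    first : ∀ k m → k ℕ.* (k ℕ.* 9 ℕ.+ 2 ℕ.* (1 ℕ.+ m ℕ.+ 2)) ℕ.+ k ℕ.* (k ℕ.* 9 ℕ.+ 2 ℕ.* (1 ℕ.+ m))
                    ℕ.+ k ℕ.* (k ℕ.* 9 ℕ.+ 2 ℕ.* (1 ℕ.+ m)) ℕ.+ k ℕ.* (k ℕ.* 9 ℕ.+ 2 ℕ.* (1 ℕ.+ m))
                  ≡ (k ℕ.+ k) ℕ.* ((k ℕ.+ k) ℕ.* 9 ℕ.+ 2 ℕ.* (1 ℕ.+ (1 ℕ.+ m) ℕ.* 2))
    first = ℕ-solve-∀
    second : ∀ k m → k ℕ.* (k ℕ.* 9 ℕ.+ 2 ℕ.* m) ℕ.+ k ℕ.* (k ℕ.* 9 ℕ.+ 2 ℕ.* (1 ℕ.+ m ℕ.+ 1))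
                     ℕ.+ k ℕ.* (k ℕ.* 9 ℕ.+ 2 ℕ.* (1 ℕ.+ m ℕ.+ 1)) ℕ.+ k ℕ.* (k ℕ.* 9 ℕ.+ 2 ℕ.* (1 ℕ.+ m ℕ.+ 1))
                   ≡ (k ℕ.+ k) ℕ.* ((k ℕ.+ k) ℕ.* 9 ℕ.+ 2 ℕ.* (1 ℕ.+ (1 ℕ.+ m) ℕ.* 2))
    second = ℕ-solve-∀
    index : ∀ k m → 1 ℕ.+ (k ℕ.* 9 ℕ.+ (1 ℕ.+ m)) ℕ.* 2 ≡ (k ℕ.+ k) ℕ.* 9 ℕ.+ (1 ℕ.+ (1 ℕ.+ m) ℕ.* 2)
    index = ℕ-solve-∀

  even-lift : ∀ k m → EvenRel T′ (suc (suc m)) → EvenRel T′ (k ℕ.* 9 ℕ.+ suc (suc m))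
  even-lift k m formula = begin
    EvenExpr T′ M
      ≡⟨ cong₂ _*_ (ward k (2 ℕ.+ m))
           (cong₂ _-_ (cong₂ (λ p q → p * q ^ 2) (ward-at k (2 ℕ.+ m ℕ.+ 2) (ℕₚ.+-assoc (k ℕ.* 9) (2 ℕ.+ m) 2))
                                               (ward-at k (suc m) (cong (_∸ 1) (ℕₚ.+-suc (k ℕ.* 9) (suc m)))))
                      (cong₂ (λ p q → p * q ^ 2) (ward-at k m (cong (_∸ 2) (trans (ℕₚ.+-suc (k ℕ.* 9) (suc m))
                                                                                  (cong suc (ℕₚ.+-suc (k ℕ.* 9) m)))))
                                               (ward-at k (2 ℕ.+ m ℕ.+ 1) (ℕₚ.+-assoc (k ℕ.* 9) (2 ℕ.+ m) 1)))) ⟩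
    (σ k (2 ℕ.+ m) * T′ (2 ℕ.+ m))
      * ((σ k (2 ℕ.+ m ℕ.+ 2) * T′ (2 ℕ.+ m ℕ.+ 2)) * (σ k (suc m) * T′ (suc m)) ^ 2
         - (σ k m * T′ m) * (σ k (2 ℕ.+ m ℕ.+ 1) * T′ (2 ℕ.+ m ℕ.+ 1)) ^ 2)
      ≡⟨ even-scaled (σ k (2 ℕ.+ m)) (σ k (2 ℕ.+ m ℕ.+ 2)) (σ k (suc m)) (σ k m) (σ k (2 ℕ.+ m ℕ.+ 1))
                     (σ (k ℕ.+ k) f) {t = T′ 2} (σ-four k (2 ℕ.+ m) (2 ℕ.+ m ℕ.+ 2) (suc m) (suc m) f (first k m))
                     (σ-four k (2 ℕ.+ m) m (2 ℕ.+ m ℕ.+ 1) (2 ℕ.+ m ℕ.+ 1) f (second k m)) formula ⟩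
    T′ 2 * (σ (k ℕ.+ k) ((2 ℕ.+ m) ℕ.* 2) * T′ ((2 ℕ.+ m) ℕ.* 2))
      ≡⟨ cong (T′ 2 *_) (sym (ward-at (k ℕ.+ k) ((2 ℕ.+ m) ℕ.* 2) (index k m))) ⟩
    T′ 2 * T′ (M ℕ.* 2) ∎
    where
    M f : ℕ
    M = k ℕ.* 9 ℕ.+ suc (suc m)
    f = (2 ℕ.+ m) ℕ.* 2
    first : ∀ k m → k ℕ.* (k ℕ.* 9 ℕ.+ 2 ℕ.* (2 ℕ.+ m)) ℕ.+ k ℕ.* (k ℕ.* 9 ℕ.+ 2 ℕ.* (2 ℕ.+ m ℕ.+ 2))
                    ℕ.+ k ℕ.* (k ℕ.* 9 ℕ.+ 2 ℕ.* (1 ℕ.+ m)) ℕ.+ k ℕ.* (k ℕ.* 9 ℕ.+ 2 ℕ.* (1 ℕ.+ m))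
                  ≡ (k ℕ.+ k) ℕ.* ((k ℕ.+ k) ℕ.* 9 ℕ.+ 2 ℕ.* ((2 ℕ.+ m) ℕ.* 2))
    first = ℕ-solve-∀
    second : ∀ k m → k ℕ.* (k ℕ.* 9 ℕ.+ 2 ℕ.* (2 ℕ.+ m)) ℕ.+ k ℕ.* (k ℕ.* 9 ℕ.+ 2 ℕ.* m)
                     ℕ.+ k ℕ.* (k ℕ.* 9 ℕ.+ 2 ℕ.* (2 ℕ.+ m ℕ.+ 1)) ℕ.+ k ℕ.* (k ℕ.* 9 ℕ.+ 2 ℕ.* (2 ℕ.+ m ℕ.+ 1))
                   ≡ (k ℕ.+ k) ℕ.* ((k ℕ.+ k) ℕ.* 9 ℕ.+ 2 ℕ.* ((2 ℕ.+ m) ℕ.* 2))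
    second = ℕ-solve-∀
    index : ∀ k m → (k ℕ.* 9 ℕ.+ (2 ℕ.+ m)) ℕ.* 2 ≡ (k ℕ.+ k) ℕ.* 9 ℕ.+ (2 ℕ.+ m) ℕ.* 2
    index = ℕ-solve-∀

  odd-all : ∀ m → 2 ≤ m → OddRel T′ m
  odd-all m 2≤m = subst (OddRel T′) (sym m≡) (odd-lift k (suc (toℕ i)) (odd-base i))
    where
    k : ℕ
    k = proj₁ (period-decomposition 2 m 2≤m)
    i : Fin 9
    i = proj₁ (proj₂ (period-decomposition 2 m 2≤m))
    m≡ : m ≡ k ℕ.* 9 ℕ.+ (2 ℕ.+ toℕ i)
    m≡ = proj₂ (proj₂ (period-decomposition 2 m 2≤m))

  even-all : ∀ m → 3 ≤ m → EvenRel T′ m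
  even-all m 3≤m = subst (EvenRel T′) (sym m≡) (even-lift k (suc (toℕ i)) (even-base i))
    where
    k : ℕ
    k = proj₁ (period-decomposition 3 m 3≤m)
    i : Fin 9
    i = proj₁ (proj₂ (period-decomposition 3 m 3≤m))
    m≡ : m ≡ k ℕ.* 9 ℕ.+ (3 ℕ.+ toℕ i)
    m≡ = proj₂ (proj₂ (period-decomposition 3 m 3≤m))

-- h is the unique sequence with its initial values and duplication formulas

-- Exact division: the quotient of b * x by b ≠ 0 is x, because the
-- remainder (x − q) * b has absolute value below ∣ b ∣.
*-/-exact : ∀ b x .{{_ : ℤ.NonZero b}} → (b * x) ℤ./ b ≡ x
*-/-exact b x = begin
  q               ≡⟨ sym (ℤₚ.+-identityˡ q) ⟩
  + 0 + q         ≡⟨ cong (_+ q) (sym (ℤₚ.∣i∣≡0⇒i≡0 {x - q} (small-multiple ∣ x - q ∣ small))) ⟩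
  (x - q) + q     ≡⟨ add-back x q ⟩
  x ∎
  where
  open ≡-Reasoning
  q : ℤ
  q = (b * x) ℤ./ b
  r : ℕ
  r = (b * x) ℤ.% b
  add-back : ∀ x q → (x - q) + q ≡ x
  add-back = solve-∀
  expand : ∀ x q b r → b * x ≡ r + q * b → (x - q) * b ≡ r
  expand x q b r eq = trans (distribute x q b) (trans (cong (_- q * b) eq) (cancel-q r (q * b)))
    where
    distribute : ∀ x q b → (x - q) * b ≡ b * x - q * b
    distribute = solve-∀
    cancel-q : ∀ r p → r + p - p ≡ r
    cancel-q = solve-∀
  small : ∣ x - q ∣ ℕ.* ∣ b ∣ < ∣ b ∣
  small = subst (_< ∣ b ∣)
    (sym (trans (sym (ℤₚ.abs-* (x - q) b)) (cong ∣_∣ (expand x q b (+ r) (ℤᵈ.a≡a%n+[a/n]*n (b * x) b)))))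
    (ℤᵈ.n%d<d (b * x) b)
  small-multiple : ∀ j {n} → j ℕ.* n < n → j ≡ 0
  small-multiple zero    _  = refl
  small-multiple (suc j) {n} lt = ⊥-elim (ℕₚ.<⇒≱ lt (ℕₚ.m≤m+n n (j ℕ.* n)))

divℤ-exact : ∀ b x → ¬ b ≡ + 0 → divℤ (b * x) b ≡ x
divℤ-exact (+ zero)     x b≢0 = ⊥-elim (b≢0 refl)
divℤ-exact b@(+[1+ _ ]) x _   = *-/-exact b x
divℤ-exact b@(-[1+ _ ]) x _   = *-/-exact b x

record Solution (α : ℤ) (t : ℕ → ℤ) : Set where
  field
    value₀ : t 0 ≡ + 0
    value₁ : t 1 ≡ + 1
    value₂ : t 2 ≡ h₂ α
    value₃ : t 3 ≡ h₃ α
    value₄ : t 4 ≡ h₄ α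
    odd    : ∀ m → 2 ≤ m → OddRel t m
    even   : ∀ m → 3 ≤ m → EvenRel t m

OddExpr-local : ∀ {s t} m → (∀ i → i ≤ m ℕ.+ 2 → s i ≡ t i) → OddExpr s m ≡ OddExpr t m
OddExpr-local m agree =
  cong₂ _-_ (cong₂ (λ p q → p * q ^ 3) (agree (m ℕ.+ 2) ℕₚ.≤-refl) (agree m (ℕₚ.m≤m+n m 2)))
            (cong₂ (λ p q → p * q ^ 3) (agree (m ∸ 1) (ℕₚ.≤-trans (ℕₚ.m∸n≤m m 1) (ℕₚ.m≤m+n m 2)))
                                      (agree (m ℕ.+ 1) (ℕₚ.+-monoʳ-≤ m (s≤s z≤n))))

EvenExpr-local : ∀ {s t} m → (∀ i → i ≤ m ℕ.+ 2 → s i ≡ t i) → EvenExpr s m ≡ EvenExpr t m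
EvenExpr-local m agree =
  cong₂ _*_ (agree m (ℕₚ.m≤m+n m 2))
    (cong₂ _-_ (cong₂ (λ p q → p * q ^ 2) (agree (m ℕ.+ 2) ℕₚ.≤-refl)
                                         (agree (m ∸ 1) (ℕₚ.≤-trans (ℕₚ.m∸n≤m m 1) (ℕₚ.m≤m+n m 2))))
               (cong₂ (λ p q → p * q ^ 2) (agree (m ∸ 2) (ℕₚ.≤-trans (ℕₚ.m∸n≤m m 2) (ℕₚ.m≤m+n m 2)))
                                         (agree (m ℕ.+ 1) (ℕₚ.+-monoʳ-≤ m (s≤s z≤n)))))

hF-odd : ∀ α f j → (5 ℕ.+ j) % 2 ≡ 1 → hF α (suc f) (5 ℕ.+ j) ≡ OddExpr (hF α f) ((5 ℕ.+ j) ℕ./ 2)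
hF-odd α f j n-odd with (5 ℕ.+ j) % 2 | n-odd
... | .1 | refl = refl

hF-even : ∀ α f j → (5 ℕ.+ j) % 2 ≡ 0 →
  hF α (suc f) (5 ℕ.+ j) ≡ divℤ (EvenExpr (hF α f) ((5 ℕ.+ j) ℕ./ 2)) (h₂ α)
hF-even α f j n-even with (5 ℕ.+ j) % 2 | n-even
... | .0 | refl = refl

parity : ∀ n → n % 2 ≡ 0 ⊎ n % 2 ≡ 1
parity n with n % 2 | ℕᵈ.m%n<n n 2
... | 0 | _ = inj₁ refl
... | 1 | _ = inj₂ refl
... | suc (suc _) | s≤s (s≤s ())

half-bound : ∀ m → m ℕ.+ 2 ≤ 2 ℕ.+ m ℕ.* 2
half-bound m = ℕₚ.≤-trans (ℕₚ.≤-reflexive (ℕₚ.+-comm m 2)) (ℕₚ.+-monoʳ-≤ 2 (ℕₚ.m≤m*n m 2))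

odd-half : ∀ m j → 5 ℕ.+ j ≡ 1 ℕ.+ m ℕ.* 2 → 2 ≤ m × m ℕ.+ 2 < 5 ℕ.+ j
odd-half 0 j ()
odd-half 1 j ()
odd-half (suc (suc m)) j n≡ = s≤s (s≤s z≤n) , subst (suc (suc m) ℕ.+ 2 <_) (sym n≡) (s≤s (s≤s (s≤s (half-bound m))))

even-half : ∀ m j → 5 ℕ.+ j ≡ m ℕ.* 2 → 3 ≤ m × m ℕ.+ 2 < 5 ℕ.+ j
even-half 0 j ()
even-half 1 j ()
even-half 2 j ()
even-half (suc (suc (suc m))) j n≡ =
  s≤s (s≤s (s≤s z≤n)) , subst (suc (suc (suc m)) ℕ.+ 2 <_) (sym n≡) (s≤s (s≤s (s≤s (s≤s (half-bound m)))))

-- Any solution of the recurrence is h, provided h₂ ≠ 0 (so that the division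
-- in the even formula is exact).
solution-unique : ∀ {α t} → ¬ h₂ α ≡ + 0 → Solution α t → ∀ n → h α n ≡ t n
solution-unique {α} {t} h₂≢0 sol n = agree (suc n) n ℕₚ.≤-refl
  where
  open Solution sol
  open ≡-Reasoning
  agree : ∀ f n → n < f → hF α f n ≡ t n
  agree (suc f) 0 _ = sym value₀
  agree (suc f) 1 _ = sym value₁
  agree (suc f) 2 _ = sym value₂
  agree (suc f) 3 _ = sym value₃
  agree (suc f) 4 _ = sym value₄
  agree (suc f) n@(suc (suc (suc (suc (suc j))))) (s≤s n≤f) with parity n
  ... | inj₂ n-odd = begin
    hF α (suc f) n      ≡⟨ hF-odd α f j n-odd ⟩
    OddExpr (hF α f) m  ≡⟨ OddExpr-local m earlier ⟩
    OddExpr t m         ≡⟨ odd m 2≤m ⟩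
    t (1 ℕ.+ m ℕ.* 2)   ≡⟨ cong t (sym n≡) ⟩
    t n ∎
    where
    m : ℕ
    m = n ℕ./ 2
    n≡ : n ≡ 1 ℕ.+ m ℕ.* 2
    n≡ = trans (ℕᵈ.m≡m%n+[m/n]*n n 2) (cong (ℕ._+ m ℕ.* 2) n-odd)
    2≤m : 2 ≤ m
    2≤m = proj₁ (odd-half m j n≡)
    earlier : ∀ i → i ≤ m ℕ.+ 2 → hF α f i ≡ t i
    earlier i i≤ = agree f i (ℕₚ.≤-<-trans i≤ (ℕₚ.<-≤-trans (proj₂ (odd-half m j n≡)) n≤f))
  ... | inj₁ n-even = begin
    hF α (suc f) n                        ≡⟨ hF-even α f j n-even ⟩
    divℤ (EvenExpr (hF α f) m) (h₂ α)     ≡⟨ cong (λ x → divℤ x (h₂ α)) (EvenExpr-local m earlier) ⟩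
    divℤ (EvenExpr t m) (h₂ α)            ≡⟨ cong (λ x → divℤ x (h₂ α)) (even m 3≤m) ⟩
    divℤ (t 2 * t (m ℕ.* 2)) (h₂ α)       ≡⟨ cong (λ x → divℤ (x * t (m ℕ.* 2)) (h₂ α)) value₂ ⟩
    divℤ (h₂ α * t (m ℕ.* 2)) (h₂ α)      ≡⟨ divℤ-exact (h₂ α) (t (m ℕ.* 2)) h₂≢0 ⟩
    t (m ℕ.* 2)                           ≡⟨ cong t (sym n≡) ⟩
    t n ∎
    where
    m : ℕ
    m = n ℕ./ 2
    n≡ : n ≡ m ℕ.* 2
    n≡ = trans (ℕᵈ.m≡m%n+[m/n]*n n 2) (cong (ℕ._+ m ℕ.* 2) n-even)
    3≤m : 3 ≤ m
    3≤m = proj₁ (even-half m j n≡)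
    earlier : ∀ i → i ≤ m ℕ.+ 2 → hF α f i ≡ t i
    earlier i i≤ = agree f i (ℕₚ.≤-<-trans i≤ (ℕₚ.<-≤-trans (proj₂ (even-half m j n≡)) n≤f))

square-product : ∀ x y → x ℕ.* y ℕ.* (x ℕ.* y) ≡ x ℕ.* x ℕ.* (y ℕ.* y)
square-product = ℕ-solve-∀

-- If a · w² = b² with w and b coprime then w = 1, since w divides b².
coprime-square-cofactor : ∀ a {w b} → Coprime w b → a ℕ.* (w ℕ.* w) ≡ b ℕ.* b → w ≡ 1
coprime-square-cofactor a {w} {b} coprime eq =
  coprime (∣-refl , coprime-divisor coprime (divides (a ℕ.* w) (trans (sym eq) (sym (ℕₚ.*-assoc a w w)))))

-- If a · w² = b² with w ≠ 0 then a is a perfect square: dividing w and b by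
-- their gcd g gives a · w′² = b′² with w′, b′ coprime, so w′ = 1 and a = b′².
square-cofactor : ∀ a w b → ¬ w ≡ 0 → a ℕ.* (w ℕ.* w) ≡ b ℕ.* b → Σ ℕ λ d → a ≡ d ℕ.* d
square-cofactor a w b w≢0 eq = b′ , (begin
  a                    ≡⟨ sym (ℕₚ.*-identityʳ a) ⟩
  a ℕ.* (1 ℕ.* 1)      ≡⟨ cong (λ x → a ℕ.* (x ℕ.* x)) (sym w′≡1) ⟩
  a ℕ.* (w′ ℕ.* w′)    ≡⟨ reduced ⟩
  b′ ℕ.* b′ ∎)
  where
  open ≡-Reasoning
  g : ℕ
  g = gcd w b
  instance
    g≢0 : ℕ.NonZero g
    g≢0 = ℕ.≢-nonZero (gcd[m,n]≢0 w b (inj₁ w≢0))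
    g²≢0 : ℕ.NonZero (g ℕ.* g)
    g²≢0 = ℕₚ.m*n≢0 g g
  w′ b′ : ℕ
  w′ = w ℕ./ g
  b′ = b ℕ./ g
  regroup : ∀ a x g → a ℕ.* (x ℕ.* g ℕ.* (x ℕ.* g)) ≡ a ℕ.* (x ℕ.* x) ℕ.* (g ℕ.* g)
  regroup = ℕ-solve-∀
  reduced : a ℕ.* (w′ ℕ.* w′) ≡ b′ ℕ.* b′
  reduced = ℕₚ.*-cancelʳ-≡ _ _ (g ℕ.* g) (begin
    a ℕ.* (w′ ℕ.* w′) ℕ.* (g ℕ.* g)     ≡⟨ sym (regroup a w′ g) ⟩
    a ℕ.* (w′ ℕ.* g ℕ.* (w′ ℕ.* g))     ≡⟨ cong (λ x → a ℕ.* (x ℕ.* x)) (ℕᵈ.m/n*n≡m (gcd[m,n]∣m w b)) ⟩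
    a ℕ.* (w ℕ.* w)                     ≡⟨ eq ⟩
    b ℕ.* b                             ≡⟨ cong (λ x → x ℕ.* x) (sym (ℕᵈ.m/n*n≡m (gcd[m,n]∣n w b))) ⟩
    b′ ℕ.* g ℕ.* (b′ ℕ.* g)             ≡⟨ square-product b′ g ⟩
    b′ ℕ.* b′ ℕ.* (g ℕ.* g) ∎)
  w′≡1 : w′ ≡ 1
  w′≡1 = coprime-square-cofactor a (coprime-/gcd w b) reduced

NatSquare : ℕ → Set
NatSquare n = Σ ℕ λ d → ¬ d ≡ 0 × n ≡ d ℕ.* d

NatSquare-scale : ∀ n {w} → ¬ w ≡ 0 → NatSquare (n ℕ.* (w ℕ.* w)) ⇔ NatSquare n
NatSquare-scale n {w} w≢0 = mk⇔ unscale scale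
  where
  unscale : NatSquare (n ℕ.* (w ℕ.* w)) → NatSquare n
  unscale (b , b≢0 , eq) = d , d≢0 , n≡dd
    where
    d : ℕ
    d = proj₁ (square-cofactor n w b w≢0 eq)
    n≡dd : n ≡ d ℕ.* d
    n≡dd = proj₂ (square-cofactor n w b w≢0 eq)
    d≢0 : ¬ d ≡ 0
    d≢0 d≡0 = [ b≢0 , b≢0 ]′ (ℕₚ.m*n≡0⇒m≡0∨n≡0 b (begin
      b ℕ.* b              ≡⟨ sym eq ⟩
      n ℕ.* (w ℕ.* w)      ≡⟨ cong (λ x → x ℕ.* (w ℕ.* w)) (trans n≡dd (cong (λ x → x ℕ.* x) d≡0)) ⟩
      0 ∎))
      where open ≡-Reasoning
  scale : NatSquare n → NatSquare (n ℕ.* (w ℕ.* w))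
  scale (d , d≢0 , refl) = d ℕ.* w , dw≢0 , sym (square-product d w)
    where
    dw≢0 : ¬ d ℕ.* w ≡ 0
    dw≢0 dw≡0 = [ d≢0 , w≢0 ]′ (ℕₚ.m*n≡0⇒m≡0∨n≡0 d dw≡0)

nonzero-pos : ∀ {d} → ¬ d ≡ 0 → ¬ + d ≡ + 0
nonzero-pos d≢0 refl = d≢0 refl

IsSquare⇔NatSquare : ∀ a → IsSquare a ⇔ NatSquare ∣ a ∣
IsSquare⇔NatSquare a = mk⇔ to (from a)
  where
  to : IsSquare a → NatSquare ∣ a ∣
  to (β , β≢0 , ±) = ∣ β ∣ , (λ ∣β∣≡0 → β≢0 (ℤₚ.∣i∣≡0⇒i≡0 ∣β∣≡0)) , abs ±
    where
    abs : a ≡ β * β ⊎ a ≡ - (β * β) → ∣ a ∣ ≡ ∣ β ∣ ℕ.* ∣ β ∣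
    abs (inj₁ refl) = ℤₚ.abs-* β β
    abs (inj₂ refl) = trans (ℤₚ.∣-i∣≡∣i∣ (β * β)) (ℤₚ.abs-* β β)
  from : ∀ a → NatSquare ∣ a ∣ → IsSquare a
  from (+ n)      (d , d≢0 , n≡dd) = + d , nonzero-pos d≢0 , inj₁ (trans (cong +_ n≡dd) (ℤₚ.pos-* d d))
  from -[1+ n ]   (d , d≢0 , n≡dd) = + d , nonzero-pos d≢0 , inj₂ (cong -_ (trans (cong +_ n≡dd) (ℤₚ.pos-* d d)))

IsSquare-scale : ∀ a {w} → ¬ w ≡ + 0 → IsSquare (a * (w * w)) ⇔ IsSquare a
IsSquare-scale a {w} w≢0 =
  ⇔-trans (IsSquare⇔NatSquare (a * (w * w)))
  (⇔-trans (subst (λ n → NatSquare n ⇔ NatSquare ∣ a ∣) (sym ∣a*w*w∣)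
                  (NatSquare-scale ∣ a ∣ (λ ∣w∣≡0 → w≢0 (ℤₚ.∣i∣≡0⇒i≡0 ∣w∣≡0))))
           (⇔-sym (IsSquare⇔NatSquare a)))
  where
  ∣a*w*w∣ : ∣ a * (w * w) ∣ ≡ ∣ a ∣ ℕ.* (∣ w ∣ ℕ.* ∣ w ∣)
  ∣a*w*w∣ = trans (ℤₚ.abs-* a (w * w)) (cong (∣ a ∣ ℕ.*_) (ℤₚ.abs-* w w))

IsSquare-neg : ∀ a → IsSquare (- a) ⇔ IsSquare a
IsSquare-neg a =
  ⇔-trans (IsSquare⇔NatSquare (- a))
  (subst (λ n → NatSquare n ⇔ IsSquare a) (sym (ℤₚ.∣-i∣≡∣i∣ a)) (⇔-sym (IsSquare⇔NatSquare a)))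

*-≢0 : ∀ {x y} → ¬ x ≡ + 0 → ¬ y ≡ + 0 → ¬ x * y ≡ + 0
*-≢0 {x} x≢0 y≢0 xy≡0 = [ x≢0 , y≢0 ]′ (ℤₚ.i*j≡0⇒i≡0∨j≡0 x xy≡0)

^-≢0 : ∀ {x} n → ¬ x ≡ + 0 → ¬ x ^ n ≡ + 0
^-≢0 {x} n x≢0 xⁿ≡0 = x≢0 (ℤₚ.i^n≡0⇒i≡0 x n xⁿ≡0)

-- γ(α) = α² − α + 1 never vanishes: otherwise α (α − 1) = −1, forcing ∣ α ∣ = 1.
γ≢0 : ∀ α → ¬ γ α ≡ + 0
γ≢0 α γ≡0 = unit-case α (ℕₚ.m*n≡1⇒m≡1 ∣ α ∣ ∣ α - + 1 ∣ ∣product∣) γ≡0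
  where
  shift : ∀ α → α * (α - + 1) ≡ α * α - α + + 1 - + 1
  shift = solve-∀
  ∣product∣ : ∣ α ∣ ℕ.* ∣ α - + 1 ∣ ≡ 1
  ∣product∣ = trans (sym (ℤₚ.abs-* α (α - + 1))) (cong ∣_∣ (trans (shift α) (cong (_- + 1) γ≡0)))
  unit-case : ∀ α → ∣ α ∣ ≡ 1 → ¬ γ α ≡ + 0
  unit-case +[1+ 0 ]     _  ()
  unit-case -[1+ 0 ]     _  ()
  unit-case (+ 0)        ()
  unit-case +[1+ suc _ ] ()
  unit-case -[1+ suc _ ] ()

module Admissible (α : ℤ) (α≢0 : ¬ α ≡ + 0) (α≢1 : ¬ α ≡ + 1) where
  open ClosedForm α
  open Tate α using (⟦_⟧; ⟦⊗⟧)

  α-1≢0 : ¬ α - + 1 ≡ + 0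
  α-1≢0 α-1≡0 = α≢1 (trans (sym (add-back α)) (cong (_+ + 1) α-1≡0))
    where
    add-back : ∀ α → α - + 1 + + 1 ≡ α
    add-back = solve-∀

  ⟦⟧≢0 : ∀ c a b d → ¬ c ≡ + 0 → ¬ ⟦ mono c a b d ⟧ ≡ + 0
  ⟦⟧≢0 c a b d c≢0 = *-≢0 c≢0 (*-≢0 (*-≢0 (^-≢0 a α≢0) (^-≢0 b α-1≢0)) (^-≢0 d (γ≢0 α)))

  h≡T′ : ∀ n → h α n ≡ T′ n
  h≡T′ = solution-unique h₂≢0 (record
    { value₀ = refl
    ; value₁ = refl
    ; value₂ = sym (neg-product (α ^ 2) (α - + 1) (γ α))
    ; value₃ = ℤₚ.-1*i≡-i _
    ; value₄ = ℤₚ.*-identityˡ _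
    ; odd    = odd-all
    ; even   = even-all
    })
    where
    neg-product : ∀ x y z → - (x * y * z) ≡ -1ℤ * (x * (y * + 1) * (z * + 1))
    neg-product = solve-∀
    h₂≢0 : ¬ h₂ α ≡ + 0
    h₂≢0 h₂≡0 = *-≢0 (*-≢0 (^-≢0 2 α≢0) α-1≢0) (γ≢0 α)
                     (trans (sym (ℤₚ.neg-involutive _)) (cong -_ h₂≡0))

  c≢0 : ¬ c ≡ + 0
  c≢0 c≡0 = ⟦⟧≢0 (+ 1) 7 4 3 (λ ()) (trans (sym c≡⟦c₉⟧) c≡0)

  h-mod-18 : ∀ n {o} → n % 18 ≡ o → Σ ℤ λ Y → ¬ Y ≡ + 0 × h α n ≡ T′ o * (Y * Y)
  h-mod-18 n {o} n%18≡o = c ^ F q o , ^-≢0 (F q o) c≢0 , (begin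
    h α n                           ≡⟨ h≡T′ n ⟩
    T′ n                            ≡⟨ ward-at (q ℕ.+ q) o n≡ ⟩
    σ (q ℕ.+ q) o * T′ o            ≡⟨ cong (_* T′ o) (σ-double q o) ⟩
    c ^ F q o * c ^ F q o * T′ o    ≡⟨ ℤₚ.*-comm _ (T′ o) ⟩
    T′ o * (c ^ F q o * c ^ F q o) ∎)
    where
    open ≡-Reasoning
    q : ℕ
    q = n ℕ./ 18
    regroup : ∀ o q → o ℕ.+ q ℕ.* 18 ≡ (q ℕ.+ q) ℕ.* 9 ℕ.+ o
    regroup = ℕ-solve-∀
    n≡ : n ≡ (q ℕ.+ q) ℕ.* 9 ℕ.+ o
    n≡ = trans (ℕᵈ.m≡m%n+[m/n]*n n 18) (trans (cong (ℕ._+ q ℕ.* 18) n%18≡o) (regroup o q))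

  square-class : ∀ n {o} x a b d → n % 18 ≡ o → T o ≡ x ⊗ (mono (+ 1) a b d ⊗ mono (+ 1) a b d) →
    IsSquare (h α n) ⇔ IsSquare ⟦ x ⟧
  square-class n {o} x a b d n%18≡o T≡ =
    subst (λ k → IsSquare k ⇔ IsSquare ⟦ x ⟧) (sym h-form) (IsSquare-scale ⟦ x ⟧ (*-≢0 z≢0 Y≢0))
    where
    open ≡-Reasoning
    Y : ℤ
    Y = proj₁ (h-mod-18 n n%18≡o)
    Y≢0 : ¬ Y ≡ + 0
    Y≢0 = proj₁ (proj₂ (h-mod-18 n n%18≡o))
    h≡ : h α n ≡ T′ o * (Y * Y)
    h≡ = proj₂ (proj₂ (h-mod-18 n n%18≡o))
    z : Mono
    z = mono (+ 1) a b d
    z≢0 : ¬ ⟦ z ⟧ ≡ + 0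
    z≢0 = ⟦⟧≢0 (+ 1) a b d (λ ())
    regroup : ∀ x z y → x * (z * z) * (y * y) ≡ x * (z * y * (z * y))
    regroup = solve-∀
    h-form : h α n ≡ ⟦ x ⟧ * (⟦ z ⟧ * Y * (⟦ z ⟧ * Y))
    h-form = begin
      h α n                               ≡⟨ h≡ ⟩
      ⟦ T o ⟧ * (Y * Y)                   ≡⟨ cong (λ m → ⟦ m ⟧ * (Y * Y)) T≡ ⟩
      ⟦ x ⊗ (z ⊗ z) ⟧ * (Y * Y)           ≡⟨ cong (_* (Y * Y)) (trans (⟦⊗⟧ x (z ⊗ z)) (cong (⟦ x ⟧ *_) (⟦⊗⟧ z z))) ⟩
      ⟦ x ⟧ * (⟦ z ⟧ * ⟦ z ⟧) * (Y * Y)   ≡⟨ regroup ⟦ x ⟧ ⟦ z ⟧ Y ⟩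
      ⟦ x ⟧ * (⟦ z ⟧ * Y * (⟦ z ⟧ * Y)) ∎

theorem5p15 : (α : ℤ) → ¬ (α ≡ + 0) → ¬ (α ≡ + 1) →
    ((n : ℕ) → (n % 18 ≡ 1 ⊎ n % 18 ≡ 17) → IsSquare (h α n))
    × ((n : ℕ) → (n % 18 ≡ 5 ⊎ n % 18 ≡ 13) → (IsSquare (h α n) ⇔ IsSquare α))
theorem5p15 α α≢0 α≢1 = part-i , part-ii
  where
  open Admissible α α≢0 α≢1
  part-i : (n : ℕ) → (n % 18 ≡ 1 ⊎ n % 18 ≡ 17) → IsSquare (h α n)
  part-i n (inj₁ n≡1)  = Equivalence.from (square-class n (mono (+ 1) 0 0 0) 0 0 0 n≡1 refl)
                                          (+ 1 , (λ ()) , inj₁ refl)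
  part-i n (inj₂ n≡17) = Equivalence.from (square-class n (mono -1ℤ 0 0 0) 112 64 48 n≡17 refl)
                                          (+ 1 , (λ ()) , inj₂ refl)
  part-ii : (n : ℕ) → (n % 18 ≡ 5 ⊎ n % 18 ≡ 13) → (IsSquare (h α n) ⇔ IsSquare α)
  part-ii n (inj₁ n≡5)  = subst (λ k → IsSquare (h α n) ⇔ IsSquare k) (unit α)
                                (square-class n (mono (+ 1) 1 0 0) 9 5 4 n≡5 refl)
    where
    unit : ∀ α → + 1 * (α * + 1 * + 1 * + 1) ≡ α
    unit = solve-∀
  part-ii n (inj₂ n≡13) = ⇔-trans (subst (λ k → IsSquare (h α n) ⇔ IsSquare k) (negated α)
                                         (square-class n (mono -1ℤ 1 0 0) 65 37 28 n≡13 refl))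
                                  (IsSquare-neg α)
    where
    negated : ∀ α → -1ℤ * (α * + 1 * + 1 * + 1) ≡ - α
    negated = solve-∀
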